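{- Let $n\ge 2$. Every pair in the set $$\{(a,b)\in\mathbb{Z}_{>0}^2: a<2^n,\ b<2^n-2^{n-2},\ a+b>2^n+2^{n-1}\}$$ is unfit in $Q_{n+1}$, and this set contains exactly $(4^{n-2}-3\cdot 2^{n-2}+2)/2$ pairs.
   Context: $Q_N=\{0,1\}^N$ is the hypercube graph (binary strings $x_0\ldots x_{N-1}$, adjacent iff they differ in exactly one digit), with automorphism group $\mathrm{Aut}(Q_N)$. Strings are identified with integers $\sum_i x_i2^{N-1-i}$; for $0\le k\le 2^N$, $I_k\subseteq Q_N$ is the set of strings with value $<k$. A pair of positive integers $(a,b)$ with $a+b\le 2^N$ is fit in $Q_N$ if there exist $g_1,g_2\in\mathrm{Aut}(Q_N)$ with $g_1(I_a)\cup g_2(I_b)=I_{a+b}$, and unfit in $Q_N$ otherwise. -}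

module Defs where

open import Data.Nat using (ℕ; zero; suc; _+_; _*_; _^_; _<_; _≤_; _∸_)
open import Data.Bool using (Bool; true; false; if_then_else_)
open import Data.Vec using (Vec; []; _∷_)
open import Data.Product using (Σ; _×_; _,_; ∃)
open import Data.Sum using (_⊎_)
open import Data.List using (List)
open import Relation.Binary.PropositionalEquality using (_≡_)
open import Relation.Nullary using (¬_)
open import Function using (_⇔_)

Vertex : ℕ → Set
Vertex N = Vec Bool N

hamming : ∀ {N} → Vertex N → Vertex N → ℕ
hamming [] [] = 0
hamming (x ∷ xs) (y ∷ ys) = (if x Data.Bool.xor y then 1 else 0) + hamming xs ys

Adjacent : ∀ {N} → Vertex N → Vertex N → Set
Adjacent x y = hamming x y ≡ 1

-- integer value  Σ x_i 2^{N-1-i}  (x₀ is the most significant digit)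
bit : Bool → ℕ
bit true = 1
bit false = 0

value : ∀ {N} → Vertex N → ℕ
value {zero} [] = 0
value {suc N} (x ∷ xs) = bit x * 2 ^ N + value xs

record Aut (N : ℕ) : Set where
  field
    fun     : Vertex N → Vertex N
    inv     : Vertex N → Vertex N
    inv-l   : ∀ x → inv (fun x) ≡ x
    inv-r   : ∀ y → fun (inv y) ≡ y
    adj     : ∀ x y → Adjacent x y ⇔ Adjacent (fun x) (fun y)
open Aut public

InI : ∀ {N} → ℕ → Vertex N → Set
InI k x = value x < k

InImage : ∀ {N} → Aut N → ℕ → Vertex N → Set
InImage {N} g k y = Σ (Vertex N) λ x → InI k x × fun g x ≡ y

Fit : ℕ → ℕ → ℕ → Set
Fit N a b = Σ (Aut N) λ g₁ → Σ (Aut N) λ g₂ →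
  ∀ y → (InImage g₁ a y ⊎ InImage g₂ b y) ⇔ InI (a + b) y

Unfit : ℕ → ℕ → ℕ → Set
Unfit N a b = (0 < a) × (0 < b) × (a + b ≤ 2 ^ N) × ¬ Fit N a b

InS : ℕ → ℕ × ℕ → Set
InS n (a , b) = (0 < a) × (0 < b) × (a < 2 ^ n) × (b < 2 ^ n ∸ 2 ^ (n ∸ 2))
              × (2 ^ n + 2 ^ (n ∸ 1) < a + b)

{-# OPTIONS --safe #-}
module Submission where

-- Automorphisms of Q_{n+1} preserve Hamming distance, so each maps the facet {x₀ = 0},
-- which contains I_a and I_b, onto some facet {y_i = γ}.  Since a + b > 2^n + 2^{n-1},
-- I_{a+b} contains every vertex of weight ≤ 2, so g₁(I_a) ∪ g₂(I_b) = I_{a+b} forces the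
-- two image facets to be opposite, {y_i = α} and {y_i = ¬α}.  Then g₂ sends each vertex of
-- {x₀ = 0} outside I_b outside I_{a+b}, i.e. into the quarter {y₀ = y₁ = 1}, and likewise for
-- g₁ and I_a.  For i ∈ {0, 1} this forces α = ¬α = 1; otherwise g₂ maps 0110…0 and 0101…1,
-- which are at distance n − 1, into the (n − 2)-cube {y₀ = y₁ = 1, y_i = ¬α}.
-- For the count, (a, b) ↦ (2^n − 1 − a, 2^n − 2^{n-2} − 1 − b) maps the set onto the
-- triangle {x + y < 2^{n-2} − 2}.

open import Defs
open import Data.Nat using (ℕ; zero; suc; _+_; _*_; _^_; _≤_; _<_; _∸_; z≤n; s≤s)
open import Data.Nat.Properties
open import Data.Nat.Tactic.RingSolver using (solve-∀)
open import Data.Bool using (Bool; true; false; not; if_then_else_; _xor_)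
import Data.Bool.Properties as Bool
open import Data.Vec using ([]; _∷_; replicate; lookup; _[_]≔_)
open import Data.Vec.Properties using (lookup∘updateAt; lookup∘updateAt′)
open import Data.Fin as Fin using (Fin)
import Data.Fin.Properties as Fin
open import Data.Product using (Σ; _×_; _,_; proj₁; proj₂; map₁)
open import Data.Sum using (_⊎_; inj₁; inj₂; [_,_]′; swap)
import Data.Sum as Sum
open import Data.Empty using (⊥; ⊥-elim)
open import Data.List using (List; []; length; map; upTo; _++_)
open import Data.List.Properties using (length-map; length-++; length-upTo; map-∘; map-id-local)
open import Data.List.Membership.Propositional using (_∈_)
open import Data.List.Membership.Propositional.Properties
  using (∈-map⁺; ∈-map⁻; ∈-++⁺ˡ; ∈-++⁺ʳ; ∈-++⁻; ∈-upTo⁺; ∈-upTo⁻)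
open import Data.List.Relation.Unary.Unique.Propositional using (Unique; [])
import Data.List.Relation.Unary.Unique.Propositional.Properties as Unique
import Data.List.Relation.Unary.All as All
open import Relation.Nullary using (¬_; yes; no)
open import Relation.Nullary.Decidable using (decidable-stable)
open import Relation.Binary.PropositionalEquality
open import Function using (_∘_; _⇔_; mk⇔; Equivalence)
open import Function.Construct.Composition using (_⇔-∘_)

bitDistance : Bool → Bool → ℕ
bitDistance x y = if x xor y then 1 else 0

bitDistance≤1 : ∀ x y → bitDistance x y ≤ 1
bitDistance≤1 x y with x xor y
... | true  = ≤-refl
... | false = z≤n

bitDistance-triangle : ∀ x y z → bitDistance x z ≤ bitDistance x y + bitDistance y z
bitDistance-triangle false false false = z≤n
bitDistance-triangle false false true  = ≤-refl
bitDistance-triangle false true  false = z≤n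
bitDistance-triangle false true  true  = ≤-refl
bitDistance-triangle true  false false = ≤-refl
bitDistance-triangle true  false true  = z≤n
bitDistance-triangle true  true  false = ≤-refl
bitDistance-triangle true  true  true  = z≤n

hamming-∷ : ∀ {N} x (xs ys : Vertex N) → hamming (x ∷ xs) (x ∷ ys) ≡ hamming xs ys
hamming-∷ x xs ys = cong (λ b → (if b then 1 else 0) + hamming xs ys) (Bool.xor-same x)

hamming-refl : ∀ {N} (x : Vertex N) → hamming x x ≡ 0
hamming-refl []       = refl
hamming-refl (x ∷ xs) = trans (hamming-∷ x xs xs) (hamming-refl xs)

hamming≡0⇒≡ : ∀ {N} {x y : Vertex N} → hamming x y ≡ 0 → x ≡ y
hamming≡0⇒≡ {x = []}         {[]}         _ = refl
hamming≡0⇒≡ {x = false ∷ xs} {false ∷ ys} e = cong (false ∷_) (hamming≡0⇒≡ e)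
hamming≡0⇒≡ {x = true ∷ xs}  {true ∷ ys}  e = cong (true ∷_) (hamming≡0⇒≡ e)

hamming-triangle : ∀ {N} (x y z : Vertex N) → hamming x z ≤ hamming x y + hamming y z
hamming-triangle []       []       []       = z≤n
hamming-triangle (a ∷ xs) (b ∷ ys) (c ∷ zs) = begin
  bitDistance a c + hamming xs zs
    ≤⟨ +-mono-≤ (bitDistance-triangle a b c) (hamming-triangle xs ys zs) ⟩
  (bitDistance a b + bitDistance b c) + (hamming xs ys + hamming ys zs)
    ≡⟨ interchange (bitDistance a b) _ _ _ ⟩
  (bitDistance a b + hamming xs ys) + (bitDistance b c + hamming ys zs) ∎
  where
  open ≤-Reasoning
  interchange : ∀ p q r s → (p + q) + (r + s) ≡ (p + r) + (q + s)
  interchange = solve-∀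

hamming≤length : ∀ {N} (x y : Vertex N) → hamming x y ≤ N
hamming≤length []       []       = z≤n
hamming≤length (a ∷ xs) (b ∷ ys) = +-mono-≤ (bitDistance≤1 a b) (hamming≤length xs ys)

hamming-agreeing : ∀ {m} (x y : Vertex (suc m)) (i : Fin (suc m)) →
                   lookup x i ≡ lookup y i → hamming x y ≤ m
hamming-agreeing (a ∷ xs) (.a ∷ ys) Fin.zero refl =
  subst (_≤ _) (sym (hamming-∷ a xs ys)) (hamming≤length xs ys)
hamming-agreeing {suc m} (a ∷ xs) (b ∷ ys) (Fin.suc i) e =
  +-mono-≤ (bitDistance≤1 a b) (hamming-agreeing xs ys i e)

hamming-step : ∀ {N} (x y : Vertex N) {k} → hamming x y ≡ suc k →
               Σ (Vertex N) λ z → Adjacent x z × hamming z y ≡ k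
hamming-step []           []           ()
hamming-step (false ∷ xs) (false ∷ ys) e = let z , p = hamming-step xs ys e in false ∷ z , p
hamming-step (true ∷ xs)  (true ∷ ys)  e = let z , p = hamming-step xs ys e in true ∷ z , p
hamming-step (false ∷ xs) (true ∷ ys)  e = true ∷ xs , cong suc (hamming-refl xs) , suc-injective e
hamming-step (true ∷ xs)  (false ∷ ys) e = false ∷ xs , cong suc (hamming-refl xs) , suc-injective e

adjacency-preserving⇒hamming-≤ : ∀ {N} (f : Vertex N → Vertex N) →
  (∀ x y → Adjacent x y → Adjacent (f x) (f y)) →
  ∀ x y → hamming (f x) (f y) ≤ hamming x y
adjacency-preserving⇒hamming-≤ f f-adj x y = go _ x y refl
  where
  go : ∀ k u v → hamming u v ≡ k → hamming (f u) (f v) ≤ k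
  go zero    u v e with refl ← hamming≡0⇒≡ {x = u} {v} e = ≤-reflexive (hamming-refl (f u))
  go (suc k) u v e =
    let w , u~w , d[w,v] = hamming-step u v e in begin
    hamming (f u) (f v)                       ≤⟨ hamming-triangle (f u) (f w) (f v) ⟩
    hamming (f u) (f w) + hamming (f w) (f v) ≤⟨ +-mono-≤ (≤-reflexive (f-adj u w u~w)) (go k w v d[w,v]) ⟩
    suc k                                     ∎
    where open ≤-Reasoning

Aut-hamming : ∀ {N} (g : Aut N) x y → hamming (fun g x) (fun g y) ≡ hamming x y
Aut-hamming g x y = ≤-antisym
  (adjacency-preserving⇒hamming-≤ (fun g) (λ u v → Equivalence.to (adj g u v)) x y)
  (subst₂ (λ u v → hamming u v ≤ _) (inv-l g x) (inv-l g y)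
    (adjacency-preserving⇒hamming-≤ (inv g) inv-adj (fun g x) (fun g y)))
  where
  inv-adj : ∀ u v → Adjacent u v → Adjacent (inv g u) (inv g v)
  inv-adj u v u~v = Equivalence.from (adj g (inv g u) (inv g v))
    (subst₂ Adjacent (sym (inv-r g u)) (sym (inv-r g v)) u~v)

Aut-injective : ∀ {N} (g : Aut N) {x y} → fun g x ≡ fun g y → x ≡ y
Aut-injective g {x} {y} e = trans (sym (inv-l g x)) (trans (cong (inv g) e) (inv-l g y))

Adjacent⇒separating-coordinate : ∀ {N} {u v : Vertex N} → Adjacent u v →
  Σ (Fin N) λ i → ∀ y → hamming y v ≡ suc (hamming y u) → lookup y i ≡ lookup u i
Adjacent⇒separating-coordinate {u = []} {[]} ()
Adjacent⇒separating-coordinate {u = false ∷ us} {false ∷ vs} u~v =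
  let i , sep = Adjacent⇒separating-coordinate u~v in
  Fin.suc i , λ { (false ∷ ys) e → sep ys e ; (true ∷ ys) e → sep ys (suc-injective e) }
Adjacent⇒separating-coordinate {u = true ∷ us} {true ∷ vs} u~v =
  let i , sep = Adjacent⇒separating-coordinate u~v in
  Fin.suc i , λ { (false ∷ ys) e → sep ys (suc-injective e) ; (true ∷ ys) e → sep ys e }
Adjacent⇒separating-coordinate {u = false ∷ us} {true ∷ vs} u~v
  with refl ← hamming≡0⇒≡ {x = us} {vs} (suc-injective u~v) =
  Fin.zero , λ { (false ∷ ys) e → refl ; (true ∷ ys) e → ⊥-elim (m≢1+n+m _ e) }
Adjacent⇒separating-coordinate {u = true ∷ us} {false ∷ vs} u~v
  with refl ← hamming≡0⇒≡ {x = us} {vs} (suc-injective u~v) =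
  Fin.zero , λ { (false ∷ ys) e → ⊥-elim (m≢1+n+m _ e) ; (true ∷ ys) e → refl }

LowerFacetImage⊆ : ∀ {n} → Aut (suc n) → Fin (suc n) → Bool → Set
LowerFacetImage⊆ g i γ = ∀ xs → lookup (fun g (false ∷ xs)) i ≡ γ

Aut-lowerFacet : ∀ {n} (g : Aut (suc n)) → Σ (Fin (suc n)) λ i → Σ Bool λ γ → LowerFacetImage⊆ g i γ
Aut-lowerFacet {n} g = proj₁ separation , _ , λ xs → proj₂ separation (fun g (false ∷ xs)) (nearer xs)
  where
  0⃗ e₀ : Vertex (suc n)
  0⃗ = false ∷ replicate n false
  e₀ = true ∷ replicate n false

  separation : Σ (Fin (suc n)) λ i → ∀ y →
    hamming y (fun g e₀) ≡ suc (hamming y (fun g 0⃗)) → lookup y i ≡ lookup (fun g 0⃗) i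
  separation = Adjacent⇒separating-coordinate
    (trans (Aut-hamming g 0⃗ e₀) (cong suc (hamming-refl (replicate n false))))

  nearer : ∀ xs → hamming (fun g (false ∷ xs)) (fun g e₀) ≡ suc (hamming (fun g (false ∷ xs)) (fun g 0⃗))
  nearer xs = begin
    hamming (fun g (false ∷ xs)) (fun g e₀)        ≡⟨ Aut-hamming g _ e₀ ⟩
    suc (hamming xs (replicate n false))           ≡⟨ cong suc (Aut-hamming g _ 0⃗) ⟨
    suc (hamming (fun g (false ∷ xs)) (fun g 0⃗))   ∎
    where open ≡-Reasoning

value<2^N : ∀ {N} (x : Vertex N) → value x < 2 ^ N
value<2^N []                   = s≤s z≤n
value<2^N {suc N} (false ∷ xs) = <-≤-trans (value<2^N xs) (m≤m+n (2 ^ N) _)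
value<2^N {suc N} (true ∷ xs)  =
  subst (λ t → t + value xs < 2 ^ N + t) (sym (+-identityʳ (2 ^ N))) (+-monoʳ-< (2 ^ N) (value<2^N xs))

value<2^n⇒head≡false : ∀ {n} b (xs : Vertex n) → value (b ∷ xs) < 2 ^ n → b ≡ false
value<2^n⇒head≡false false xs _ = refl
value<2^n⇒head≡false {n} true xs lt =
  ⊥-elim (<⇒≱ lt (≤-trans (m≤m+n (2 ^ n) 0) (m≤m+n _ (value xs))))

value-replicate-false : ∀ n → value (replicate n false) ≡ 0
value-replicate-false zero    = refl
value-replicate-false (suc n) = value-replicate-false n

1+value-replicate-true : ∀ n → suc (value (replicate n true)) ≡ 2 ^ n
1+value-replicate-true zero    = refl
1+value-replicate-true (suc n) = begin
  suc ((2 ^ n + 0) + value (replicate n true)) ≡⟨ +-suc (2 ^ n + 0) _ ⟨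
  (2 ^ n + 0) + suc (value (replicate n true)) ≡⟨ cong₂ _+_ (+-identityʳ (2 ^ n)) (1+value-replicate-true n) ⟩
  2 ^ n + 2 ^ n                                ≡⟨ cong (2 ^ n +_) (+-identityʳ (2 ^ n)) ⟨
  2 ^ suc n                                    ∎
  where open ≡-Reasoning

value>⇒head-true-true : ∀ {k} (y : Vertex (2 + k)) → 2 ^ (1 + k) + 2 ^ k < value y →
  Σ (Vertex k) λ ys → y ≡ true ∷ true ∷ ys
value>⇒head-true-true {k} (false ∷ ys) lt =
  ⊥-elim (<⇒≱ (value<2^N ys) (≤-trans (m≤m+n (2 ^ (1 + k)) _) (<⇒≤ lt)))
value>⇒head-true-true {k} (true ∷ false ∷ ys) lt =
  ⊥-elim (<⇒≱ lt (<⇒≤ (subst (λ t → t + value ys < 2 ^ (1 + k) + 2 ^ k) (sym (+-identityʳ _))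
                         (+-monoʳ-< (2 ^ (1 + k)) (value<2^N ys)))))
value>⇒head-true-true (true ∷ true ∷ ys) lt = ys , refl

weight : ∀ {N} → Vertex N → ℕ
weight = hamming (replicate _ false)

weight-replicate-true : ∀ n → weight (replicate n true) ≡ n
weight-replicate-true zero    = refl
weight-replicate-true (suc n) = cong suc (weight-replicate-true n)

weight-[]≔ : ∀ {N} (x : Vertex N) i c → weight (x [ i ]≔ c) ≤ suc (weight x)
weight-[]≔ {N} x i c = ≤-trans (hamming-triangle (replicate N false) x (x [ i ]≔ c))
  (≤-trans (≤-reflexive (+-comm (weight x) _)) (+-monoˡ-≤ (weight x) (distance-[]≔ x i)))
  where
  distance-[]≔ : ∀ {N} (x : Vertex N) i → hamming x (x [ i ]≔ c) ≤ 1
  distance-[]≔ (a ∷ xs) Fin.zero    = +-mono-≤ (bitDistance≤1 a c) (≤-reflexive (hamming-refl xs))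
  distance-[]≔ (a ∷ xs) (Fin.suc i) = subst (_≤ 1) (sym (hamming-∷ a xs _)) (distance-[]≔ xs i)

weight≤1⇒value≤ : ∀ {n} (x : Vertex (suc n)) → weight x ≤ 1 → value x ≤ 2 ^ n
weight≤1⇒value≤ {n} (true ∷ xs) (s≤s w≤0)
  with refl ← hamming≡0⇒≡ {x = replicate n false} {xs} (n≤0⇒n≡0 w≤0) =
  ≤-reflexive (trans (cong ((2 ^ n + 0) +_) (value-replicate-false n)) (trans (+-identityʳ _) (+-identityʳ _)))
weight≤1⇒value≤ (false ∷ xs) _ = <⇒≤ (value<2^N xs)

weight≤2⇒value≤ : ∀ {k} (x : Vertex (2 + k)) → weight x ≤ 2 → value x ≤ 2 ^ (1 + k) + 2 ^ k
weight≤2⇒value≤ {k} (true ∷ xs) (s≤s w≤1) =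
  subst (λ t → t + value xs ≤ 2 ^ (1 + k) + 2 ^ k) (sym (+-identityʳ _))
        (+-monoʳ-≤ (2 ^ (1 + k)) (weight≤1⇒value≤ xs w≤1))
weight≤2⇒value≤ (false ∷ xs) _ = ≤-trans (<⇒≤ (value<2^N xs)) (m≤m+n _ _)

InImage-lowerFacet : ∀ {n c} (g : Aut (suc n)) {i : Fin (suc n)} {γ : Bool} → c ≤ 2 ^ n →
  LowerFacetImage⊆ g i γ → ∀ {y} → InImage g c y → lookup y i ≡ γ
InImage-lowerFacet g c≤2^n facet (b ∷ xs , x<c , refl)
  with refl ← value<2^n⇒head≡false b xs (<-≤-trans x<c c≤2^n) = facet xs

weight≤2-vertex-outside-facets : ∀ {N} (i j : Fin N) (α β : Bool) → i ≢ j ⊎ α ≡ β →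
  Σ (Vertex N) λ y → weight y ≤ 2 × lookup y i ≡ not α × lookup y j ≡ not β
weight≤2-vertex-outside-facets {N} i j α β apart = y , light , lookup∘updateAt i z , y[j] apart
  where
  z y : Vertex N
  z = replicate N false [ j ]≔ not β
  y = z [ i ]≔ not α

  light : weight y ≤ 2
  light = ≤-trans (weight-[]≔ z i _)
    (s≤s (≤-trans (weight-[]≔ _ j _) (s≤s (≤-reflexive (hamming-refl (replicate N false))))))

  y[j] : i ≢ j ⊎ α ≡ β → lookup y j ≡ not β
  y[j] apart′ with i Fin.≟ j | apart′
  ... | yes refl | inj₁ i≢i  = ⊥-elim (i≢i refl)
  ... | yes refl | inj₂ refl = lookup∘updateAt i z
  ... | no i≢j   | _         =
    trans (lookup∘updateAt′ j i (i≢j ∘ sym) z) (lookup∘updateAt j (replicate N false))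

facets-covering-I⇒opposite : ∀ {k c} {i j : Fin (2 + k)} {α β : Bool} →
  (∀ y → value y < c → lookup y i ≡ α ⊎ lookup y j ≡ β) → 2 ^ (1 + k) + 2 ^ k < c →
  i ≡ j × α ≢ β
facets-covering-I⇒opposite {i = i} {j} {α} {β} cover T<c =
  decidable-stable (i Fin.≟ j) (uncovered ∘ inj₁) , uncovered ∘ inj₂
  where
  uncovered : ¬ (i ≢ j ⊎ α ≡ β)
  uncovered apart with weight≤2-vertex-outside-facets i j α β apart
  ... | y , light , y[i] , y[j] =
    [ (λ e → Bool.not-¬ e y[i]) , (λ e → Bool.not-¬ e y[j]) ]′
      (cover y (≤-<-trans (weight≤2⇒value≤ y light) T<c))

image∉I : ∀ {N c s} (g : Aut N) {Other : Vertex N → Set} →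
  (∀ y → value y < s → InImage g c y ⊎ Other y) →
  ∀ x → c ≤ value x → ¬ Other (fun g x) → s ≤ value (fun g x)
image∉I g cover x c≤x ¬other = ≮⇒≥ λ gx<s →
  [ (λ { (x′ , x′<c , gx′≡gx) →
          <⇒≱ (subst (λ z → value z < _) (Aut-injective g gx′≡gx) x′<c) c≤x })
  , ¬other
  ]′ (cover _ gx<s)

top-quarter-split : ∀ {m} (i : Fin (3 + m)) →
  (∀ y → 2 ^ (2 + m) + 2 ^ (1 + m) < value y → lookup y i ≡ true) ⊎
  (∀ y y′ → 2 ^ (2 + m) + 2 ^ (1 + m) < value y → 2 ^ (2 + m) + 2 ^ (1 + m) < value y′ →
     lookup y i ≡ lookup y′ i → hamming y y′ ≤ m)
top-quarter-split Fin.zero =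
  inj₁ λ y T<y → cong (λ v → lookup v Fin.zero) (proj₂ (value>⇒head-true-true y T<y))
top-quarter-split (Fin.suc Fin.zero) =
  inj₁ λ y T<y → cong (λ v → lookup v (Fin.suc Fin.zero)) (proj₂ (value>⇒head-true-true y T<y))
top-quarter-split {m} (Fin.suc (Fin.suc i)) =
  inj₂ λ y y′ T<y T<y′ → thin (value>⇒head-true-true y T<y) (value>⇒head-true-true y′ T<y′)
  where
  thin : ∀ {y y′ : Vertex (3 + m)} →
    Σ (Vertex (1 + m)) (λ ys → y ≡ true ∷ true ∷ ys) →
    Σ (Vertex (1 + m)) (λ ys → y′ ≡ true ∷ true ∷ ys) →
    lookup y (Fin.suc (Fin.suc i)) ≡ lookup y′ (Fin.suc (Fin.suc i)) → hamming y y′ ≤ m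
  thin (ys , refl) (ys′ , refl) = hamming-agreeing ys ys′ i

2^[1+m]+2^m≤2^[2+m] : ∀ m → 2 ^ (1 + m) + 2 ^ m ≤ 2 ^ (2 + m)
2^[1+m]+2^m≤2^[2+m] m = +-monoʳ-≤ (2 ^ (1 + m)) (≤-trans (m≤m+n (2 ^ m) _) (m≤m+n _ 0))

opposite-lowerFacet-images⇒¬covering : ∀ {m a b} (g₁ g₂ : Aut (3 + m)) {i : Fin (3 + m)} {α β : Bool} →
  a < 2 ^ (2 + m) → b < 2 ^ (1 + m) + 2 ^ m → 2 ^ (2 + m) + 2 ^ (1 + m) < a + b →
  LowerFacetImage⊆ g₁ i α → LowerFacetImage⊆ g₂ i β → α ≢ β →
  ¬ (∀ y → value y < a + b → InImage g₁ a y ⊎ InImage g₂ b y)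
opposite-lowerFacet-images⇒¬covering {m} {a} {b} g₁ g₂ {i} {α} {β}
                                     a< b< T<a+b g₁-facet g₂-facet α≢β cover =
  [ α≢β ∘ α≡β , <⇒≱ far ∘ near ]′ (top-quarter-split i)
  where
  a≤ : a ≤ 2 ^ (2 + m)
  a≤ = <⇒≤ a<
  b≤ : b ≤ 2 ^ (2 + m)
  b≤ = ≤-trans (<⇒≤ b<) (2^[1+m]+2^m≤2^[2+m] m)

  high₁ : ∀ xs → a ≤ value (false ∷ xs) → 2 ^ (2 + m) + 2 ^ (1 + m) < value (fun g₁ (false ∷ xs))
  high₁ xs a≤x = <-≤-trans T<a+b (image∉I g₁ cover (false ∷ xs) a≤x
    (λ in₂ → α≢β (trans (sym (g₁-facet xs)) (InImage-lowerFacet g₂ b≤ g₂-facet in₂))))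

  high₂ : ∀ xs → b ≤ value (false ∷ xs) → 2 ^ (2 + m) + 2 ^ (1 + m) < value (fun g₂ (false ∷ xs))
  high₂ xs b≤x = <-≤-trans T<a+b (image∉I g₂ (λ y y< → swap (cover y y<)) (false ∷ xs) b≤x
    (λ in₁ → α≢β (trans (sym (InImage-lowerFacet g₁ a≤ g₁-facet in₁)) (g₂-facet xs))))

  ones p q : Vertex (2 + m)
  ones = replicate (2 + m) true
  p = true ∷ true ∷ replicate m false
  q = true ∷ false ∷ replicate m true

  a≤ones : a ≤ value (false ∷ ones)
  a≤ones = ≤-pred (subst (a <_) (sym (1+value-replicate-true (2 + m))) a<)

  b≤p : b ≤ value (false ∷ p)
  b≤p = <⇒≤ (subst (b <_) (sym value-p) b<)
    where
    value-p : value p ≡ 2 ^ (1 + m) + 2 ^ m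
    value-p = cong₂ _+_ (+-identityʳ _)
      (trans (cong (2 ^ m + 0 +_) (value-replicate-false m)) (trans (+-identityʳ _) (+-identityʳ _)))

  b≤q : b ≤ value (false ∷ q)
  b≤q = ≤-pred (subst (b <_) (sym 1+value-q) b<)
    where
    1+value-q : suc (value q) ≡ 2 ^ (1 + m) + 2 ^ m
    1+value-q = trans (sym (+-suc (2 ^ (1 + m) + 0) _)) (cong₂ _+_ (+-identityʳ _) (1+value-replicate-true m))

  α≡β : (∀ y → 2 ^ (2 + m) + 2 ^ (1 + m) < value y → lookup y i ≡ true) → α ≡ β
  α≡β top = begin
    α                                ≡⟨ g₁-facet ones ⟨
    lookup (fun g₁ (false ∷ ones)) i ≡⟨ top (fun g₁ (false ∷ ones)) (high₁ ones a≤ones) ⟩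
    true                             ≡⟨ top (fun g₂ (false ∷ p)) (high₂ p b≤p) ⟨
    lookup (fun g₂ (false ∷ p)) i    ≡⟨ g₂-facet p ⟩
    β                                ∎
    where open ≡-Reasoning

  near : (∀ y y′ → 2 ^ (2 + m) + 2 ^ (1 + m) < value y → 2 ^ (2 + m) + 2 ^ (1 + m) < value y′ →
            lookup y i ≡ lookup y′ i → hamming y y′ ≤ m) →
         hamming (fun g₂ (false ∷ p)) (fun g₂ (false ∷ q)) ≤ m
  near thin = thin (fun g₂ (false ∷ p)) (fun g₂ (false ∷ q)) (high₂ p b≤p) (high₂ q b≤q)
                   (trans (g₂-facet p) (sym (g₂-facet q)))

  far : m < hamming (fun g₂ (false ∷ p)) (fun g₂ (false ∷ q))
  far = ≤-reflexive (sym (trans (Aut-hamming g₂ _ _) (cong suc (weight-replicate-true m))))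

¬Fit : ∀ {m a b} → a < 2 ^ (2 + m) → b < 2 ^ (1 + m) + 2 ^ m → 2 ^ (2 + m) + 2 ^ (1 + m) < a + b →
  ¬ Fit (3 + m) a b
¬Fit {m} a< b< T<a+b (g₁ , g₂ , fit)
  with Aut-lowerFacet g₁ | Aut-lowerFacet g₂
... | i , α , g₁-facet | j , β , g₂-facet
  with facets-covering-I⇒opposite {i = i} {j} {α} {β}
         (λ y y< → Sum.map (InImage-lowerFacet g₁ (<⇒≤ a<) g₁-facet)
                           (InImage-lowerFacet g₂ (≤-trans (<⇒≤ b<) (2^[1+m]+2^m≤2^[2+m] m)) g₂-facet)
                           (Equivalence.from (fit y) y<))
         T<a+b
... | refl , α≢β =
  opposite-lowerFacet-images⇒¬covering g₁ g₂ a< b< T<a+b g₁-facet g₂-facet α≢β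
    (λ y → Equivalence.from (fit y))

column : ℕ → List (ℕ × ℕ)
column k = map (0 ,_) (upTo k)

length-column : ∀ k → length (column k) ≡ k
length-column k = trans (length-map _ (upTo k)) (length-upTo k)

triangle : ℕ → List (ℕ × ℕ)
triangle zero    = []
triangle (suc k) = column (suc k) ++ map (map₁ suc) (triangle k)

∈-triangle⇔ : ∀ {k x y} → (x , y) ∈ triangle k ⇔ x + y < k
∈-triangle⇔ = mk⇔ to from
  where
  to : ∀ {k x y} → (x , y) ∈ triangle k → x + y < k
  to {suc k} p∈ with ∈-++⁻ (column (suc k)) p∈
  ... | inj₁ p∈₀ with _ , y∈ , refl ← ∈-map⁻ (0 ,_) p∈₀ = ∈-upTo⁻ y∈
  ... | inj₂ p∈₊ with _ , q∈ , refl ← ∈-map⁻ (map₁ suc) p∈₊ = s≤s (to q∈)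
  from : ∀ {k x y} → x + y < k → (x , y) ∈ triangle k
  from {suc k} {zero}  y<k           = ∈-++⁺ˡ (∈-map⁺ (0 ,_) (∈-upTo⁺ y<k))
  from {suc k} {suc x} (s≤s x+y<k)   = ∈-++⁺ʳ (column (suc k)) (∈-map⁺ (map₁ suc) (from x+y<k))

triangle-unique : ∀ k → Unique (triangle k)
triangle-unique zero    = []
triangle-unique (suc k) = Unique.++⁺
  (Unique.map⁺ (cong proj₂) (Unique.upTo⁺ (suc k)))
  (Unique.map⁺ (λ e → cong₂ _,_ (suc-injective (cong proj₁ e)) (cong proj₂ e)) (triangle-unique k))
  disjoint
  where
  disjoint : ∀ {p} → p ∈ column (suc k) × p ∈ map (map₁ suc) (triangle k) → ⊥
  disjoint (p∈₀ , p∈₊) with _ , _ , refl ← ∈-map⁻ (0 ,_) p∈₀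
                       with _ , _ , ()   ← ∈-map⁻ (map₁ suc) p∈₊

2*length-triangle : ∀ k → 2 * length (triangle k) ≡ k * suc k
2*length-triangle zero    = refl
2*length-triangle (suc k) = begin
  2 * length (column (suc k) ++ map (map₁ suc) (triangle k))
    ≡⟨ cong (2 *_) (length-++ (column (suc k)) {map (map₁ suc) (triangle k)}) ⟩
  2 * (length (column (suc k)) + length (map (map₁ suc) (triangle k)))
    ≡⟨ cong₂ (λ s t → 2 * (s + t)) (length-column (suc k)) (length-map _ (triangle k)) ⟩
  2 * (suc k + length (triangle k))
    ≡⟨ *-distribˡ-+ 2 (suc k) _ ⟩
  2 * suc k + 2 * length (triangle k)
    ≡⟨ cong (2 * suc k +_) (2*length-triangle k) ⟩
  2 * suc k + k * suc k
    ≡⟨ *-distribʳ-+ (suc k) 2 k ⟨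
  (2 + k) * suc k
    ≡⟨ *-comm (2 + k) (suc k) ⟩
  suc k * suc (suc k) ∎
  where open ≡-Reasoning

reflect : ℕ → ℕ → ℕ
reflect K u = K ∸ suc u

+-reflect : ∀ {K u} → u < K → u + suc (reflect K u) ≡ K
+-reflect {K} {u} u<K = trans (+-suc u (reflect K u)) (m+[n∸m]≡n u<K)

reflect< : ∀ {K u} → u < K → reflect K u < K
reflect< {K} {u} u<K = subst (reflect K u <_) (+-reflect u<K) (m≤n+m (suc (reflect K u)) u)

reflect-involutive : ∀ {K u} → u < K → reflect K (reflect K u) ≡ u
reflect-involutive {K} {u} u<K =
  trans (cong (_∸ suc (reflect K u)) (sym (+-reflect u<K))) (m+n∸n≡m u (suc (reflect K u)))

reflectPair : ℕ → ℕ → ℕ × ℕ → ℕ × ℕ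
reflectPair A B (a , b) = reflect A a , reflect B b

reflectPair-involutive : ∀ {A B a b} → a < A → b < B → reflectPair A B (reflectPair A B (a , b)) ≡ (a , b)
reflectPair-involutive a<A b<B = cong₂ _,_ (reflect-involutive a<A) (reflect-involutive b<B)

+-reflectPair : ∀ {A B a b} → a < A → b < B → (a + b) + (2 + (reflect A a + reflect B b)) ≡ A + B
+-reflectPair {A} {B} {a} {b} a<A b<B = begin
  (a + b) + (2 + (reflect A a + reflect B b))        ≡⟨ regroup a b (reflect A a) (reflect B b) ⟩
  (a + suc (reflect A a)) + (b + suc (reflect B b))  ≡⟨ cong₂ _+_ (+-reflect a<A) (+-reflect b<B) ⟩
  A + B                                              ∎
  where
  open ≡-Reasoning
  regroup : ∀ a b x y → (a + b) + (2 + (x + y)) ≡ (a + suc x) + (b + suc y)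
  regroup = solve-∀

-- Thanks to truncated subtraction this also holds when w < 2 + s.
threshold⇔ : ∀ {s t u w} → u + (2 + t) ≡ w → s < u ⇔ t < w ∸ (2 + s)
threshold⇔ {s} {t} {u} {w} w≡ = mk⇔ to from
  where
  to : s < u → t < w ∸ (2 + s)
  to s<u = m+n≤o⇒m≤o∸n (suc t) (begin
    suc t + (2 + s) ≡⟨ swap-ends t s ⟩
    suc s + (2 + t) ≤⟨ +-monoˡ-≤ (2 + t) s<u ⟩
    u + (2 + t)     ≡⟨ w≡ ⟩
    w               ∎)
    where
    open ≤-Reasoning
    swap-ends : ∀ t s → suc t + (2 + s) ≡ suc s + (2 + t)
    swap-ends = solve-∀
  from : t < w ∸ (2 + s) → s < u
  from t<w∸ = ≰⇒> λ u≤s → <⇒≱ t<w∸ (m≤n+o⇒m∸n≤o w (2 + s) (begin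
    w           ≡⟨ w≡ ⟨
    u + (2 + t) ≤⟨ +-monoˡ-≤ (2 + t) u≤s ⟩
    s + (2 + t) ≡⟨ regroup s t ⟩
    (2 + s) + t ∎))
    where
    open ≤-Reasoning
    regroup : ∀ s t → s + (2 + t) ≡ (2 + s) + t
    regroup = solve-∀

InCorner : ℕ → ℕ → ℕ → ℕ × ℕ → Set
InCorner A B s (a , b) = a < A × b < B × s < a + b

corner : ℕ → ℕ → ℕ → List (ℕ × ℕ)
corner A B s = map (reflectPair A B) (triangle (A + B ∸ (2 + s)))

triangle⇒bounded : ∀ {A B s x y} → A ≤ 2 + s → B ≤ 2 + s →
  (x , y) ∈ triangle (A + B ∸ (2 + s)) → x < A × y < B
triangle⇒bounded {A} {B} {s} {x} {y} A≤ B≤ xy∈ =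
  <-≤-trans (≤-<-trans (m≤m+n x y) x+y<k) (subst (k ≤_) (m+n∸n≡m A B) (∸-monoʳ-≤ (A + B) B≤)) ,
  <-≤-trans (≤-<-trans (m≤n+m y x) x+y<k) (subst (k ≤_) (m+n∸m≡n A B) (∸-monoʳ-≤ (A + B) A≤))
  where
  k : ℕ
  k = A + B ∸ (2 + s)
  x+y<k : x + y < k
  x+y<k = Equivalence.to ∈-triangle⇔ xy∈

∈-corner⇔ : ∀ {A B s} → A ≤ 2 + s → B ≤ 2 + s →
            ∀ {a b} → (a , b) ∈ corner A B s ⇔ InCorner A B s (a , b)
∈-corner⇔ {A} {B} {s} A≤ B≤ = mk⇔ to from
  where
  to : ∀ {a b} → (a , b) ∈ corner A B s → InCorner A B s (a , b)
  to ab∈ with (x , y) , xy∈ , refl ← ∈-map⁻ (reflectPair A B) ab∈ =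
    let x<A , y<B = triangle⇒bounded A≤ B≤ xy∈
        sum≡ = subst₂ (λ x′ y′ → (reflect A x + reflect B y) + (2 + (x′ + y′)) ≡ A + B)
                      (reflect-involutive x<A) (reflect-involutive y<B)
                      (+-reflectPair (reflect< x<A) (reflect< y<B))
    in reflect< x<A , reflect< y<B , Equivalence.from (threshold⇔ sum≡) (Equivalence.to ∈-triangle⇔ xy∈)
  from : ∀ {a b} → InCorner A B s (a , b) → (a , b) ∈ corner A B s
  from (a<A , b<B , s<a+b) = subst (_∈ corner A B s) (reflectPair-involutive a<A b<B)
    (∈-map⁺ (reflectPair A B)
      (Equivalence.from ∈-triangle⇔ (Equivalence.to (threshold⇔ (+-reflectPair a<A b<B)) s<a+b)))

-- reflectPair A B is not injective on ℕ × ℕ, but it is an involution on the triangle.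
corner-unique : ∀ {A B s} → A ≤ 2 + s → B ≤ 2 + s → Unique (corner A B s)
corner-unique {A} {B} {s} A≤ B≤ =
  Unique.map⁻ (subst Unique (sym reflected) (triangle-unique (A + B ∸ (2 + s))))
  where
  reflected : map (reflectPair A B) (corner A B s) ≡ triangle (A + B ∸ (2 + s))
  reflected = trans (sym (map-∘ (triangle (A + B ∸ (2 + s))))) (map-id-local (All.tabulate λ xy∈ →
    let x<A , y<B = triangle⇒bounded A≤ B≤ xy∈ in reflectPair-involutive x<A y<B))

length-corner : ∀ A B s → length (corner A B s) ≡ length (triangle (A + B ∸ (2 + s)))
length-corner A B s = length-map (reflectPair A B) (triangle (A + B ∸ (2 + s)))

2^[2+m]∸2^m : ∀ m → 2 ^ (2 + m) ∸ 2 ^ m ≡ 2 ^ (1 + m) + 2 ^ m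
2^[2+m]∸2^m m = trans (cong (_∸ 2 ^ m) (split (2 ^ m))) (m+n∸n≡m (2 ^ (1 + m) + 2 ^ m) (2 ^ m))
  where
  split : ∀ P → 2 * (2 * P) ≡ (2 * P + P) + P
  split = solve-∀

n≤o<m+n⇒0<m : ∀ {m n o} → n ≤ o → o < m + n → 0 < m
n≤o<m+n⇒0<m {zero}  n≤o o<n = ⊥-elim (<⇒≱ o<n n≤o)
n≤o<m+n⇒0<m {suc m} _   _   = s≤s z≤n

4^m≡2^m*2^m : ∀ m → 4 ^ m ≡ 2 ^ m * 2 ^ m
4^m≡2^m*2^m zero    = refl
4^m≡2^m*2^m (suc m) = trans (cong (4 *_) (4^m≡2^m*2^m m)) (regroup (2 ^ m))
  where
  regroup : ∀ P → 4 * (P * P) ≡ (2 * P) * (2 * P)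
  regroup = solve-∀

2*length-triangle[P∸2] : ∀ {P} → 1 ≤ P → 2 * length (triangle (P ∸ 2)) + 3 * P ≡ P * P + 2
2*length-triangle[P∸2] {1}           _ = refl
2*length-triangle[P∸2] {suc (suc Q)} _ = begin
  2 * length (triangle Q) + 3 * (2 + Q) ≡⟨ cong (_+ 3 * (2 + Q)) (2*length-triangle Q) ⟩
  Q * suc Q + 3 * (2 + Q)               ≡⟨ complete-square Q ⟩
  (2 + Q) * (2 + Q) + 2                 ∎
  where
  open ≡-Reasoning
  complete-square : ∀ Q → Q * suc Q + 3 * (2 + Q) ≡ (2 + Q) * (2 + Q) + 2
  complete-square = solve-∀

module S-corner (m : ℕ) where

  A B s : ℕ
  A = 2 ^ (2 + m)
  B = 2 ^ (2 + m) ∸ 2 ^ m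
  s = 2 ^ (2 + m) + 2 ^ (1 + m)

  A≤2+s : A ≤ 2 + s
  A≤2+s = ≤-trans (m≤m+n A _) (m≤n+m s 2)

  B≤2+s : B ≤ 2 + s
  B≤2+s = ≤-trans (m∸n≤m A (2 ^ m)) A≤2+s

  InCorner⇔InS : ∀ {a b} → InCorner A B s (a , b) ⇔ InS (2 + m) (a , b)
  InCorner⇔InS {a} {b} = mk⇔
    (λ c@(a<A , b<B , s<a+b) →
       n≤o<m+n⇒0<m (≤-trans (<⇒≤ b<B) (≤-trans (m∸n≤m A (2 ^ m)) (m≤m+n A _))) s<a+b ,
       n≤o<m+n⇒0<m (≤-trans (<⇒≤ a<A) (m≤m+n A _)) (subst (s <_) (+-comm a b) s<a+b) ,
       c)
    (λ (_ , _ , c) → c)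

  A+B∸[2+s]≡2^m∸2 : A + B ∸ (2 + s) ≡ 2 ^ m ∸ 2
  A+B∸[2+s]≡2^m∸2 = begin
    A + B ∸ (2 + s)                     ≡⟨ cong (λ t → A + t ∸ (2 + s)) (2^[2+m]∸2^m m) ⟩
    A + (2 ^ (1 + m) + 2 ^ m) ∸ (2 + s) ≡⟨ cong₂ _∸_ (sym (+-assoc A _ (2 ^ m))) (+-comm 2 s) ⟩
    (s + 2 ^ m) ∸ (s + 2)               ≡⟨ [m+n]∸[m+o]≡n∸o s (2 ^ m) 2 ⟩
    2 ^ m ∸ 2                           ∎
    where open ≡-Reasoning

  2*length-corner : 2 * length (corner A B s) + 3 * 2 ^ m ≡ 4 ^ m + 2
  2*length-corner = begin
    2 * length (corner A B s) + 3 * 2 ^ m         ≡⟨ cong (λ L → 2 * L + 3 * 2 ^ m) length≡ ⟩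
    2 * length (triangle (2 ^ m ∸ 2)) + 3 * 2 ^ m ≡⟨ 2*length-triangle[P∸2] (m^n>0 2 m) ⟩
    2 ^ m * 2 ^ m + 2                             ≡⟨ cong (_+ 2) (4^m≡2^m*2^m m) ⟨
    4 ^ m + 2                                     ∎
    where
    open ≡-Reasoning
    length≡ : length (corner A B s) ≡ length (triangle (2 ^ m ∸ 2))
    length≡ = trans (length-corner A B s) (cong (length ∘ triangle) A+B∸[2+s]≡2^m∸2)

mainTheorem7 : (n : ℕ) → 2 ≤ n →
    ((a b : ℕ) → InS n (a , b) → Unfit (suc n) a b)
    × Σ (List (ℕ × ℕ)) (λ L → Unique L × (∀ p → p ∈ L ⇔ InS n p)
        × (2 * length L + 3 * 2 ^ (n ∸ 2) ≡ 4 ^ (n ∸ 2) + 2))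
mainTheorem7 (suc zero) (s≤s ())
mainTheorem7 (suc (suc m)) _ =
  unfit ,
  corner A B s ,
  corner-unique A≤2+s B≤2+s ,
  (λ _ → InCorner⇔InS ⇔-∘ ∈-corner⇔ A≤2+s B≤2+s) ,
  2*length-corner
  where
  open S-corner m
  unfit : (a b : ℕ) → InS (2 + m) (a , b) → Unfit (3 + m) a b
  unfit a b (0<a , 0<b , a<A , b<B , s<a+b) =
    0<a , 0<b ,
    +-mono-≤ (<⇒≤ a<A) (≤-trans (<⇒≤ b<B) (≤-trans (m∸n≤m A (2 ^ m)) (m≤m+n A 0))) ,
    ¬Fit a<A (subst (b <_) (2^[2+m]∸2^m m) b<B) s<a+b
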